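{- Let $\sigma$ and $\tau$ be vincular patterns. Suppose $|\mathcal{S}_\lambda^{C,\emptyset}(\sigma)|=|\mathcal{S}_\lambda^{C,\emptyset}(\tau)|$ for all Young boards $\lambda$ and all sets $C\subseteq[\operatorname{width}(\lambda)]$. Then $\sigma$ and $\tau$ are filling-shape-Wilf-equivalent.
   Context: A vincular pattern of length $k$ is a pair $(\sigma,X)$ with $\sigma\in S_k$ and $X\subseteq[k-1]$. A Young board $\lambda=(\lambda_1,\dots,\lambda_n)$ with $\lambda_1\ge\dots\ge\lambda_n>0$ is the cell set $\{(i,j):1\le i\le n,\ 1\le j\le\lambda_i\}$, with width $n$ and height $\lambda_1$. A filling is a $0/1$ assignment to the cells with at most one $1$ per row and per column. It is encoded by the word $\pi_1\cdots\pi_n$ with $\pi_c=r$ if $(c,r)$ holds a $1$ and $\pi_c=\square$ if column $c$ is empty. A filling $\pi$ contains $(\sigma,X)$ if there are $i_1<\dots<i_k$ such that all of the following hold: - all $\pi_{i_j}$ are numbers; - $\pi_{i_1}\cdots\pi_{i_k}$ is order-isomorphic to $\sigma$; - $i_{j+1}=i_j+1$ for $j\in X$; - the cell $(i_k,\max_j\pi_{i_j})$ lies in $\lambda$. Otherwise $\pi$ avoids $(\sigma,X)$. $\mathcal{S}_\lambda^{C,R}(\sigma)$ denotes the set of fillings of $\lambda$ with empty columns exactly $C$ and empty rows exactly $R$ that avoid $\sigma$. $\sigma,\tau$ are filling-shape-Wilf-equivalent if $|\mathcal{S}_\lambda^{C,R}(\sigma)|=|\mathcal{S}_\lambda^{C,R}(\tau)|$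 for all Young boards $\lambda$ and all $C\subseteq[\text{width}]$, $R\subseteq[\text{height}]$. -}

module Defs where

open import Data.Nat as ℕ using (ℕ; zero; suc; _<_; _≤_; _⊔_)
open import Data.Fin as Fin using (Fin; toℕ; inject₁; fromℕ)
open import Data.Fin.Subset using (Subset; _∈_; ⊥)
open import Data.Fin.Permutation using (Permutation′; _⟨$⟩ʳ_)
open import Data.Maybe using (Maybe; just; nothing)
open import Data.Vec using (Vec; lookup)
open import Data.List using (List; length)
open import Data.List.Relation.Unary.Unique.Propositional using (Unique)
import Data.List.Membership.Propositional as LM
open import Data.Product using (Σ; ∃; _×_; _,_; proj₁)
open import Relation.Binary.PropositionalEquality using (_≡_; _≢_)
open import Relation.Nullary using (¬_)
open import Function.Bundles using (_⇔_)

-- A vincular pattern of length k = suc m : a permutation σ ∈ S_k and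
-- X ⊆ [k-1], represented 0-indexed as X : Subset m, where j ∈ X means
-- the (0-indexed) pattern positions inject₁ j and suc j must be adjacent.
record Vincular : Set where
  field
    m   : ℕ
    σ   : Permutation′ (suc m)
    X   : Subset m
open Vincular public

len : Vincular → ℕ
len p = suc (m p)

record YoungBoard : Set where
  field
    width  : ℕ
    col    : Fin width → ℕ
    col-pos : ∀ c → 0 < col c
    col-dec : ∀ c d → c Fin.≤ d → col d ≤ col c
open YoungBoard public

height : YoungBoard → ℕ
height record { width = zero } = 0
height record { width = suc n ; col = h } = h Fin.zero

InBoard : (λ' : YoungBoard) → Fin (width λ') → ℕ → Set
InBoard λ' c r = r < col λ' c

-- Words of length n over rows (ℕ, 0-indexed) or empty (nothing = □).
Word : ℕ → Set
Word n = Vec (Maybe ℕ) n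

-- w is a filling of λ : every 1 lies in λ, at most one 1 per row
-- (at most one per column is built into the encoding).
IsFilling : (λ' : YoungBoard) → Word (width λ') → Set
IsFilling λ' w =
  (∀ c r → lookup w c ≡ just r → InBoard λ' c r) ×
  (∀ c d r → lookup w c ≡ just r → lookup w d ≡ just r → c ≡ d)

maxF : ∀ m → (Fin (suc m) → ℕ) → ℕ
maxF zero f = f Fin.zero
maxF (suc m) f = f Fin.zero ⊔ maxF m (λ i → f (Fin.suc i))

Contains : (λ' : YoungBoard) → Word (width λ') → Vincular → Set
Contains λ' w p =
  Σ (Fin (len p) → Fin (width λ')) λ i →
  Σ (Fin (len p) → ℕ) λ v →
    (∀ a b → a Fin.< b → i a Fin.< i b) ×
    (∀ a → lookup w (i a) ≡ just (v a)) ×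
    (∀ a b → (v a < v b) ⇔ ((σ p ⟨$⟩ʳ a) Fin.< (σ p ⟨$⟩ʳ b))) ×
    (∀ j → j ∈ X p → toℕ (i (Fin.suc j)) ≡ suc (toℕ (i (inject₁ j)))) ×
    InBoard λ' (i (fromℕ (m p))) (maxF (m p) v)

Avoids : (λ' : YoungBoard) → Word (width λ') → Vincular → Set
Avoids λ' w p = ¬ Contains λ' w p

EmptyCols : (λ' : YoungBoard) → Word (width λ') → Subset (width λ') → Set
EmptyCols λ' w C = ∀ c → (c ∈ C) ⇔ (lookup w c ≡ nothing)

EmptyRows : (λ' : YoungBoard) → Word (width λ') → Subset (height λ') → Set
EmptyRows λ' w R = ∀ r → (r ∈ R) ⇔ (∀ c → lookup w c ≢ just (toℕ r))

InS : (λ' : YoungBoard) → Subset (width λ') → Subset (height λ') → Vincular →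
      Word (width λ') → Set
InS λ' C R p w = IsFilling λ' w × EmptyCols λ' w C × EmptyRows λ' w R × Avoids λ' w p

HasSize : {A : Set} → (A → Set) → ℕ → Set
HasSize {A} P k = Σ (List A) λ l → Unique l × length l ≡ k × (∀ a → (a LM.∈ l) ⇔ P a)

SameSize : {A : Set} → (A → Set) → (A → Set) → Set
SameSize P Q = ∃ λ k → HasSize P k × HasSize Q k

FillingShapeWilfEquiv : Vincular → Vincular → Set
FillingShapeWilfEquiv σ τ =
  ∀ (λ' : YoungBoard) (C : Subset (width λ')) (R : Subset (height λ')) →
    SameSize (InS λ' C R σ) (InS λ' C R τ)

module Submission where

-- Write P(λ, C, R) for |S_λ^{C,R}(σ)| = |S_λ^{C,R}(τ)|.  We prove
-- P for every board λ and all C, R by induction on width + height; R = ∅ is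
-- exactly the hypothesis.  If R ∋ r is nonempty:
--  * if some row ρ ∉ R lies inside the last (shortest) column, deleting the
--    empty row r leaves a Young board λ∖r, and relabelling rows is a bijection
--    S_λ^{C,R}(π) ≅ S_{λ∖r}^{C,R∖r}(π) for every pattern π;
--  * otherwise every row of the last column is forced empty: if that column is
--    not in C there is no filling at all; if it is, deleting it is a bijection
--    onto the fillings of the narrower board (a one-column board has exactly
--    one filling, the empty word).
-- Both bijections preserve containment, since the row relabelling is strictly
-- increasing and the deleted row or column carries no 1.  The file develops
-- counting along bijections, the relabelling arithmetic, facts on subsets and
-- words, the two deletions, the degenerate cases, and finally the induction.

open import Defs
open import Data.Nat as ℕ using (ℕ; zero; suc; _<_; _≤_; _+_; _⊔_; z≤n; s≤s; z<s; s<s; _<?_)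
import Data.Nat.Properties as ℕP
open import Data.Fin as Fin using (Fin; toℕ; inject₁; fromℕ; fromℕ<; lower₁)
import Data.Fin.Properties as FP
open import Data.Fin.Subset using (Subset; _∈_; _∉_; ⊥)
open import Data.Fin.Subset.Properties using (_∈?_; nonempty?; ∉⊥)
open import Data.Maybe as Maybe using (just; nothing)
open import Data.Vec as Vec using (Vec; lookup; []; _∷_; _∷ʳ_)
import Data.Vec.Properties as VP
import Data.List as List
import Data.List.Relation.Unary.Unique.Propositional.Properties as UniqueP
import Data.List.Membership.Propositional as LM
import Data.List.Membership.Propositional.Properties as LMP
open import Data.List.Properties using (length-map)
open import Data.List.Relation.Unary.Any using (here)
open import Data.List.Relation.Unary.AllPairs using ([]; _∷_)
open import Data.List.Relation.Unary.All using ([])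
open import Data.Product using (∃; _×_; _,_; proj₁; proj₂)
open import Data.Sum using (_⊎_; inj₁; inj₂)
open import Data.Empty using (⊥-elim)
open import Relation.Binary.PropositionalEquality
open import Relation.Nullary using (¬_; yes; no)
open import Relation.Nullary.Decidable using (_×-dec_; ¬?)
open import Function.Bundles using (_⇔_; mk⇔; Equivalence)
open import Function.Related.TypeIsomorphisms using (¬-cong-⇔)
open import Data.Product.Function.NonDependent.Propositional using (_×-⇔_)
open import Data.Fin.Permutation using (_⟨$⟩ʳ_)
import Function.Properties.Equivalence as ⇔
open Equivalence using (to; from)

-- Counting along a bijection

hasSize-transport : {A B : Set} {P : A → Set} {P' : B → Set} (g : A → B) (h : B → A) →
  (∀ a → P a → a ≡ h (g a)) → (∀ b → g (h b) ≡ b) → (∀ b → P (h b) ⇔ P' b) →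
  ∀ {k} → HasSize P' k → HasSize P k
hasSize-transport {P = P} g h hg≡id gh≡id P∘h⇔P' (l , unique , length≡ , mem) =
  List.map h l , UniqueP.map⁺ h-injective unique , trans (length-map h l) length≡ ,
  λ a → mk⇔ (sound a) (complete a)
  where
  h-injective : ∀ {x y} → h x ≡ h y → x ≡ y
  h-injective {x} {y} e = trans (sym (gh≡id x)) (trans (cong g e) (gh≡id y))
  sound : ∀ a → a LM.∈ List.map h l → P a
  sound a a∈ with LMP.∈-map⁻ h a∈
  ... | b , b∈ , refl = from (P∘h⇔P' b) (to (mem b) b∈)
  complete : ∀ a → P a → a LM.∈ List.map h l
  complete a pa = subst (LM._∈ List.map h l) (sym (hg≡id a pa))
    (LMP.∈-map⁺ h (from (mem (g a)) (to (P∘h⇔P' (g a)) (subst P (hg≡id a pa) pa))))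

sameSize-transport : {A B : Set} {P Q : A → Set} {P' Q' : B → Set} (g : A → B) (h : B → A) →
  (∀ a → P a → a ≡ h (g a)) → (∀ a → Q a → a ≡ h (g a)) → (∀ b → g (h b) ≡ b) →
  (∀ b → P (h b) ⇔ P' b) → (∀ b → Q (h b) ⇔ Q' b) →
  SameSize P' Q' → SameSize P Q
sameSize-transport g h retP retQ sec eqvP eqvQ (k , sizeP , sizeQ) =
  k , hasSize-transport g h retP sec eqvP sizeP , hasSize-transport g h retQ sec eqvQ sizeQ

hasSize-none : {A : Set} (P : A → Set) → (∀ a → ¬ P a) → HasSize P 0
hasSize-none P none = List.[] , [] , refl , λ a → mk⇔ (λ ()) (λ pa → ⊥-elim (none a pa))

hasSize-single : {A : Set} (P : A → Set) (a₀ : A) → P a₀ → (∀ a → P a → a ≡ a₀) → HasSize P 1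
hasSize-single P a₀ pa₀ only = (a₀ List.∷ List.[]) , ([] ∷ []) , refl ,
  λ a → mk⇔ (λ { (here refl) → pa₀ }) (λ pa → here (only a pa))

-- Row relabelling for the deletion of row r

-- Row y of the board without row r is row  ins r y  of the original board
-- (y if y < r, y + 1 otherwise); del r is its inverse away from r.
ins : ℕ → ℕ → ℕ
ins zero y = suc y
ins (suc r) zero = zero
ins (suc r) (suc y) = suc (ins r y)

del : ℕ → ℕ → ℕ
del zero x = ℕ.pred x
del (suc r) zero = zero
del (suc r) (suc x) = suc (del r x)

-- The height of a column of height h once row r is deleted.
cut : ℕ → ℕ → ℕ
cut zero zero = zero
cut zero (suc h) = h
cut (suc r) zero = zero
cut (suc r) (suc h) = suc (cut r h)

del-ins : ∀ r y → del r (ins r y) ≡ y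
del-ins zero y = refl
del-ins (suc r) zero = refl
del-ins (suc r) (suc y) = cong suc (del-ins r y)

ins-del : ∀ r x → x ≢ r → ins r (del r x) ≡ x
ins-del zero zero x≢r = ⊥-elim (x≢r refl)
ins-del zero (suc x) x≢r = refl
ins-del (suc r) zero x≢r = refl
ins-del (suc r) (suc x) x≢r = cong suc (ins-del r x (λ e → x≢r (cong suc e)))

ins≢ : ∀ r y → ins r y ≢ r
ins≢ zero y ()
ins≢ (suc r) zero ()
ins≢ (suc r) (suc y) e = ins≢ r y (ℕP.suc-injective e)

ins-injective : ∀ r {y z} → ins r y ≡ ins r z → y ≡ z
ins-injective r {y} {z} e = trans (sym (del-ins r y)) (trans (cong (del r) e) (del-ins r z))

-- ins r is an order embedding, so it preserves order-isomorphism types ...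
ins-<⇔ : ∀ r {y z} → (y < z) ⇔ (ins r y < ins r z)
ins-<⇔ r = mk⇔ (mono r) (reflect r)
  where
  mono : ∀ r {y z} → y < z → ins r y < ins r z
  mono zero p = s<s p
  mono (suc r) {zero} {suc z} p = z<s
  mono (suc r) {suc y} {suc z} (s<s p) = s<s (mono r p)
  reflect : ∀ r {y z} → ins r y < ins r z → y < z
  reflect zero (s<s p) = p
  reflect (suc r) {zero} {suc z} p = z<s
  reflect (suc r) {suc y} {suc z} (s<s p) = s<s (reflect r p)

ins-⊔ : ∀ r a b → ins r (a ⊔ b) ≡ ins r a ⊔ ins r b
ins-⊔ zero a b = refl
ins-⊔ (suc r) zero b = refl
ins-⊔ (suc r) (suc a) zero = refl
ins-⊔ (suc r) (suc a) (suc b) = cong suc (ins-⊔ r a b)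

ins<⇔<cut : ∀ r y h → (ins r y < h) ⇔ (y < cut r h)
ins<⇔<cut r y h = mk⇔ (to′ r y h) (from′ r y h)
  where
  to′ : ∀ r y h → ins r y < h → y < cut r h
  to′ zero y (suc h) (s<s p) = p
  to′ (suc r) zero (suc h) p = z<s
  to′ (suc r) (suc y) (suc h) (s<s p) = s<s (to′ r y h p)
  from′ : ∀ r y h → y < cut r h → ins r y < h
  from′ zero y (suc h) p = s<s p
  from′ (suc r) zero (suc h) p = z<s
  from′ (suc r) (suc y) (suc h) (s<s p) = s<s (from′ r y h p)

cut-mono : ∀ r {h h'} → h ≤ h' → cut r h ≤ cut r h'
cut-mono zero {zero} p = z≤n
cut-mono zero {suc h} {suc h'} (s≤s p) = p
cut-mono (suc r) {zero} p = z≤n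
cut-mono (suc r) {suc h} {suc h'} (s≤s p) = s≤s (cut-mono r p)

-- ... strictly lowers the first column (the induction measure) ...
cut< : ∀ r h → r < h → cut r h < h
cut< zero (suc h) p = ℕP.n<1+n h
cut< (suc r) (suc h) (s<s p) = s<s (cut< r h p)

cut-pos : ∀ r ρ h → ρ < h → ρ ≢ r → 0 < cut r h
cut-pos r ρ h ρ<h ρ≢r =
  ℕP.<-≤-trans z<s (to (ins<⇔<cut r (del r ρ) h) (subst (_< h) (sym (ins-del r ρ ρ≢r)) ρ<h))

maxF-ext : ∀ m (f g : Fin (suc m) → ℕ) → (∀ a → f a ≡ g a) → maxF m f ≡ maxF m g
maxF-ext zero f g e = e Fin.zero
maxF-ext (suc m) f g e = cong₂ _⊔_ (e Fin.zero) (maxF-ext m _ _ (λ a → e (Fin.suc a)))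

maxF-map : ∀ (φ : ℕ → ℕ) → (∀ a b → φ (a ⊔ b) ≡ φ a ⊔ φ b) →
  ∀ m (f : Fin (suc m) → ℕ) → maxF m (λ a → φ (f a)) ≡ φ (maxF m f)
maxF-map φ φ-⊔ zero f = refl
maxF-map φ φ-⊔ (suc m) f =
  trans (cong (φ (f Fin.zero) ⊔_) (maxF-map φ φ-⊔ m _)) (sym (φ-⊔ _ _))

restrict : ∀ {k n} → (Fin k → Fin n) → Subset n → Subset k
restrict f S = Vec.tabulate (λ x → lookup S (f x))

∈-restrict : ∀ {k n} (f : Fin k → Fin n) (S : Subset n) x → (x ∈ restrict f S) ⇔ (f x ∈ S)
∈-restrict f S x = mk⇔
  (λ x∈ → VP.lookup⇒[]= (f x) S (trans (sym (VP.lookup∘tabulate _ x)) (VP.[]=⇒lookup x∈)))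
  (λ fx∈ → VP.lookup⇒[]= x _ (trans (VP.lookup∘tabulate _ x) (VP.[]=⇒lookup fx∈)))

forced : ∀ {H} (R : Subset H) h → ¬ (∃ λ ρ → toℕ ρ < h × ρ ∉ R) → ∀ ρ → toℕ ρ < h → ρ ∈ R
forced R h none ρ ρ<h with ρ ∈? R
... | yes ρ∈R = ρ∈R
... | no ρ∉R = ⊥-elim (none (ρ , ρ<h , ρ∉R))

lastOrInject₁ : ∀ {k} (c : Fin (suc k)) → (c ≡ fromℕ k) ⊎ (∃ λ c' → c ≡ inject₁ c')
lastOrInject₁ {zero} Fin.zero = inj₁ refl
lastOrInject₁ {suc k} Fin.zero = inj₂ (Fin.zero , refl)
lastOrInject₁ {suc k} (Fin.suc c) with lastOrInject₁ c
... | inj₁ e = inj₁ (cong Fin.suc e)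
... | inj₂ (c' , e) = inj₂ (Fin.suc c' , cong Fin.suc e)

mkBoard : (n : ℕ) (col : Fin (suc n) → ℕ) → (∀ c → 0 < col c) →
  (∀ c d → c Fin.≤ d → col d ≤ col c) → YoungBoard
mkBoard n col cp cd = record { width = suc n ; col = col ; col-pos = cp ; col-dec = cd }

RowEmpty : ∀ {n} → Word n → ℕ → Set
RowEmpty w ρ = ∀ c → lookup w c ≢ just ρ

relabel : ∀ {n} → (ℕ → ℕ) → Word n → Word n
relabel f w = Vec.map (Maybe.map f) w

lookup-relabel : ∀ {n} f (w : Word n) c → lookup (relabel f w) c ≡ Maybe.map f (lookup w c)
lookup-relabel f w c = VP.lookup-map c (Maybe.map f) w

relabel-just : ∀ {n} f (w : Word n) c {y} → lookup (relabel f w) c ≡ just y →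
  ∃ λ x → lookup w c ≡ just x × f x ≡ y
relabel-just f w c e = map-just (lookup w c) (trans (sym (lookup-relabel f w c)) e)
  where
  map-just : ∀ m {y} → Maybe.map f m ≡ just y → ∃ λ x → m ≡ just x × f x ≡ y
  map-just (just x) refl = x , refl , refl

relabel-nothing : ∀ {n} f (w : Word n) c → (lookup (relabel f w) c ≡ nothing) ⇔ (lookup w c ≡ nothing)
relabel-nothing f w c =
  ⇔.trans (mk⇔ (trans (sym (lookup-relabel f w c))) (trans (lookup-relabel f w c))) (map-nothing (lookup w c))
  where
  map-nothing : ∀ m → (Maybe.map f m ≡ nothing) ⇔ (m ≡ nothing)
  map-nothing (just x) = mk⇔ (λ ()) (λ ())
  map-nothing nothing = mk⇔ (λ _ → refl) (λ _ → refl)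

relabel-inverse : ∀ {n} f g (w : Word n) → (∀ c x → lookup w c ≡ just x → g (f x) ≡ x) →
  relabel g (relabel f w) ≡ w
relabel-inverse f g [] inv = refl
relabel-inverse f g (nothing ∷ w) inv = cong (nothing ∷_) (relabel-inverse f g w (λ c → inv (Fin.suc c)))
relabel-inverse f g (just x ∷ w) inv =
  cong₂ _∷_ (cong just (inv Fin.zero x refl)) (relabel-inverse f g w (λ c → inv (Fin.suc c)))

lookup-∷ʳ-inject₁ : ∀ {A : Set} {k} (xs : Vec A k) x i → lookup (xs ∷ʳ x) (inject₁ i) ≡ lookup xs i
lookup-∷ʳ-inject₁ (y ∷ ys) x Fin.zero = refl
lookup-∷ʳ-inject₁ (y ∷ ys) x (Fin.suc i) = lookup-∷ʳ-inject₁ ys x i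

lookup-∷ʳ-last : ∀ {A : Set} {k} (xs : Vec A k) x → lookup (xs ∷ʳ x) (fromℕ k) ≡ x
lookup-∷ʳ-last [] x = refl
lookup-∷ʳ-last (y ∷ ys) x = lookup-∷ʳ-last ys x

∷ʳ-init : ∀ {A : Set} {k} (xs : Vec A (suc k)) {x} → lookup xs (fromℕ k) ≡ x → xs ≡ Vec.init xs ∷ʳ x
∷ʳ-init (y ∷ []) e = cong (_∷ []) e
∷ʳ-init (y ∷ z ∷ zs) e = cong (y ∷_) (∷ʳ-init (z ∷ zs) e)

-- Deleting an empty row

-- λ₀ is a board of width suc n, r one of its rows, and λ₁ the board with
-- row r deleted; cp₁ says that every column of λ₁ is still nonempty.
module DeleteRow (n : ℕ) (col : Fin (suc n) → ℕ) (cp : ∀ c → 0 < col c)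
  (cd : ∀ c d → c Fin.≤ d → col d ≤ col c)
  (r : Fin (col Fin.zero)) (cp₁ : ∀ c → 0 < cut (toℕ r) (col c)) where

  rr : ℕ
  rr = toℕ r

  col₁ : Fin (suc n) → ℕ
  col₁ c = cut rr (col c)

  λ₀ λ₁ : YoungBoard
  λ₀ = mkBoard n col cp cd
  λ₁ = mkBoard n col₁ cp₁ (λ c d c≤d → cut-mono rr (cd c d c≤d))

  rowOf : Fin (height λ₁) → Fin (height λ₀)
  rowOf j = fromℕ< (from (ins<⇔<cut rr (toℕ j) (col Fin.zero)) (FP.toℕ<n j))

  toℕ-rowOf : ∀ j → toℕ (rowOf j) ≡ ins rr (toℕ j)
  toℕ-rowOf j = FP.toℕ-fromℕ< _

  rowOf-onto : ∀ ρ → toℕ ρ ≢ rr → ∃ λ j → rowOf j ≡ ρ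
  rowOf-onto ρ ρ≢r = fromℕ< y<H₁ , FP.toℕ-injective (begin
      toℕ (rowOf (fromℕ< y<H₁))    ≡⟨ toℕ-rowOf (fromℕ< y<H₁) ⟩
      ins rr (toℕ (fromℕ< y<H₁))  ≡⟨ cong (ins rr) (FP.toℕ-fromℕ< y<H₁) ⟩
      ins rr (del rr (toℕ ρ))      ≡⟨ ins-del rr (toℕ ρ) ρ≢r ⟩
      toℕ ρ                        ∎)
    where
    open ≡-Reasoning
    y<H₁ : del rr (toℕ ρ) < height λ₁
    y<H₁ = to (ins<⇔<cut rr _ _) (subst (_< col Fin.zero) (sym (ins-del rr (toℕ ρ) ρ≢r)) (FP.toℕ<n ρ))

  lift lower : Word (suc n) → Word (suc n)
  lift = relabel (ins rr)
  lower = relabel (del rr)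

  lower∘lift : ∀ w₁ → lower (lift w₁) ≡ w₁
  lower∘lift w₁ = relabel-inverse (ins rr) (del rr) w₁ (λ _ x _ → del-ins rr x)

  lift∘lower : ∀ w → RowEmpty w rr → w ≡ lift (lower w)
  lift∘lower w empty = sym (relabel-inverse (del rr) (ins rr) w
    (λ c x e → ins-del rr x (λ x≡r → empty c (trans e (cong just x≡r)))))

  lift-just : ∀ w₁ c {y} → lookup w₁ c ≡ just y → lookup (lift w₁) c ≡ just (ins rr y)
  lift-just w₁ c e = trans (lookup-relabel (ins rr) w₁ c) (cong (Maybe.map (ins rr)) e)

  lift-rowEmpty-r : ∀ w₁ → RowEmpty (lift w₁) rr
  lift-rowEmpty-r w₁ c e with relabel-just (ins rr) w₁ c e
  ... | y , _ , ins≡r = ins≢ rr y ins≡r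

  lift-rowEmpty : ∀ w₁ j → RowEmpty (lift w₁) (toℕ (rowOf j)) ⇔ RowEmpty w₁ (toℕ j)
  lift-rowEmpty w₁ j rewrite toℕ-rowOf j = mk⇔
    (λ empty c e → empty c (lift-just w₁ c e))
    (λ empty c e → let (y , e₁ , e₂) = relabel-just (ins rr) w₁ c e
                   in empty c (trans e₁ (cong just (ins-injective rr e₂))))

  lift-isFilling : ∀ w₁ → IsFilling λ₀ (lift w₁) ⇔ IsFilling λ₁ w₁
  lift-isFilling w₁ = mk⇔
    (λ (inBoard , rowsDistinct) →
       (λ c y e → to (ins<⇔<cut rr y (col c)) (inBoard c (ins rr y) (lift-just w₁ c e))) ,
       (λ c d y e₁ e₂ → rowsDistinct c d (ins rr y) (lift-just w₁ c e₁) (lift-just w₁ d e₂)))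
    (λ (inBoard , rowsDistinct) →
       (λ c x e → let (y , e₁ , e₂) = relabel-just (ins rr) w₁ c e
                  in subst (_< col c) e₂ (from (ins<⇔<cut rr y (col c)) (inBoard c y e₁))) ,
       (λ c d x e₁ e₂ → let (y₁ , f₁ , g₁) = relabel-just (ins rr) w₁ c e₁
                            (y₂ , f₂ , g₂) = relabel-just (ins rr) w₁ d e₂
                        in rowsDistinct c d y₁ f₁ (trans f₂ (cong just (ins-injective rr (trans g₂ (sym g₁)))))))

  lift-emptyCols : ∀ w₁ C → EmptyCols λ₀ (lift w₁) C ⇔ EmptyCols λ₁ w₁ C
  lift-emptyCols w₁ C = mk⇔
    (λ empty c → ⇔.trans (empty c) (relabel-nothing (ins rr) w₁ c))
    (λ empty c → ⇔.trans (empty c) (⇔.sym (relabel-nothing (ins rr) w₁ c)))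

  lift-emptyRows : ∀ {R} → r ∈ R → ∀ w₁ → EmptyRows λ₀ (lift w₁) R ⇔ EmptyRows λ₁ w₁ (restrict rowOf R)
  lift-emptyRows {R} r∈R w₁ = mk⇔
    (λ empty j → ⇔.trans (∈-restrict rowOf R j) (⇔.trans (empty (rowOf j)) (lift-rowEmpty w₁ j)))
    rowsOfλ₀
    where
    rowsOfλ₀ : EmptyRows λ₁ w₁ (restrict rowOf R) → EmptyRows λ₀ (lift w₁) R
    rowsOfλ₀ empty ρ with toℕ ρ ℕP.≟ rr
    ... | yes ρ≡r = mk⇔ (λ _ → subst (RowEmpty (lift w₁)) (sym ρ≡r) (lift-rowEmpty-r w₁))
                        (λ _ → subst (_∈ R) (sym (FP.toℕ-injective ρ≡r)) r∈R)
    ... | no ρ≢r with rowOf-onto ρ ρ≢r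
    ...   | j , refl = ⇔.trans (⇔.sym (∈-restrict rowOf R j)) (⇔.trans (empty j) (⇔.sym (lift-rowEmpty w₁ j)))

  lift-contains⁺ : ∀ p w₁ → Contains λ₁ w₁ p → Contains λ₀ (lift w₁) p
  lift-contains⁺ p w₁ (i , v , mono , look , order , adjacent , inBoard) =
    i , (λ a → ins rr (v a)) , mono , (λ a → lift-just w₁ (i a) (look a)) ,
    (λ a b → ⇔.trans (⇔.sym (ins-<⇔ rr)) (order a b)) , adjacent ,
    subst (_< col (i (fromℕ (m p)))) (sym (maxF-map (ins rr) (ins-⊔ rr) (m p) v))
      (from (ins<⇔<cut rr _ _) inBoard)

  lift-contains⁻ : ∀ p w₁ → Contains λ₀ (lift w₁) p → Contains λ₁ w₁ p
  lift-contains⁻ p w₁ (i , v , mono , look , order , adjacent , inBoard) =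
    i , v₁ , mono , look₁ , order₁ , adjacent , inBoard₁
    where
    v₁ : Fin (len p) → ℕ
    v₁ a = del rr (v a)
    ins-v₁ : ∀ a → ins rr (v₁ a) ≡ v a
    ins-v₁ a = let (y , _ , ins≡v) = relabel-just (ins rr) w₁ (i a) (look a)
               in ins-del rr (v a) (λ v≡r → ins≢ rr y (trans ins≡v v≡r))
    look₁ : ∀ a → lookup w₁ (i a) ≡ just (v₁ a)
    look₁ a = let (y , e , ins≡v) = relabel-just (ins rr) w₁ (i a) (look a)
              in trans e (cong just (trans (sym (del-ins rr y)) (cong (del rr) ins≡v)))
    order₁ : ∀ a b → (v₁ a < v₁ b) ⇔ ((σ p ⟨$⟩ʳ a) Fin.< (σ p ⟨$⟩ʳ b))
    order₁ a b = ⇔.trans (subst₂ (λ x y → (v₁ a < v₁ b) ⇔ (x < y)) (ins-v₁ a) (ins-v₁ b) (ins-<⇔ rr)) (order a b)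
    inBoard₁ : maxF (m p) v₁ < col₁ (i (fromℕ (m p)))
    inBoard₁ = to (ins<⇔<cut rr _ _) (subst (_< col (i (fromℕ (m p))))
      (trans (sym (maxF-ext (m p) _ _ ins-v₁)) (maxF-map (ins rr) (ins-⊔ rr) (m p) v₁)) inBoard)

  lift-InS : ∀ {C R} → r ∈ R → ∀ p w₁ → InS λ₀ C R p (lift w₁) ⇔ InS λ₁ C (restrict rowOf R) p w₁
  lift-InS {C} r∈R p w₁ =
    lift-isFilling w₁ ×-⇔ lift-emptyCols w₁ C ×-⇔ lift-emptyRows r∈R w₁ ×-⇔
    ¬-cong-⇔ (mk⇔ (lift-contains⁻ p w₁) (lift-contains⁺ p w₁))

  sameSize-deleteRow : ∀ {C R} (σ τ : Vincular) → r ∈ R →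
    SameSize (InS λ₁ C (restrict rowOf R) σ) (InS λ₁ C (restrict rowOf R) τ) →
    SameSize (InS λ₀ C R σ) (InS λ₀ C R τ)
  sameSize-deleteRow {C} {R} σ τ r∈R =
    sameSize-transport lower lift (rowIsEmpty σ) (rowIsEmpty τ) lower∘lift (lift-InS r∈R σ) (lift-InS r∈R τ)
    where
    rowIsEmpty : ∀ p w → InS λ₀ C R p w → w ≡ lift (lower w)
    rowIsEmpty p w (_ , _ , empty , _) = lift∘lower w (to (empty r) r∈R)

-- Deleting an empty last column

-- λ₀ is a board of width suc (suc n) and λ₁ the board without its last column
-- L; a filling of λ₁ extends to λ₀ by leaving L empty.  Both boards have the
-- same height, so the row sets agree.
module DeleteLastColumn (n : ℕ) (col : Fin (suc (suc n)) → ℕ) (cp : ∀ c → 0 < col c)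
  (cd : ∀ c d → c Fin.≤ d → col d ≤ col c) where

  L : Fin (suc (suc n))
  L = fromℕ (suc n)

  λ₀ λ₁ : YoungBoard
  λ₀ = mkBoard (suc n) col cp cd
  λ₁ = mkBoard n (λ c → col (inject₁ c)) (λ c → cp (inject₁ c))
    (λ c d c≤d → cd (inject₁ c) (inject₁ d)
       (subst₂ _≤_ (sym (FP.toℕ-inject₁ c)) (sym (FP.toℕ-inject₁ d)) c≤d))

  extend : Word (suc n) → Word (suc (suc n))
  extend w₁ = w₁ ∷ʳ nothing

  extend-inject₁ : ∀ w₁ c → lookup (extend w₁) (inject₁ c) ≡ lookup w₁ c
  extend-inject₁ w₁ = lookup-∷ʳ-inject₁ w₁ nothing

  extend-L : ∀ w₁ → lookup (extend w₁) L ≡ nothing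
  extend-L w₁ = lookup-∷ʳ-last w₁ nothing

  extend∘init : ∀ w → lookup w L ≡ nothing → w ≡ extend (Vec.init w)
  extend∘init w = ∷ʳ-init w

  extend-just : ∀ w₁ c {y} → lookup (extend w₁) c ≡ just y → ∃ λ c' → c ≡ inject₁ c'
  extend-just w₁ c e with lastOrInject₁ c
  ... | inj₂ old = old
  ... | inj₁ refl with trans (sym (extend-L w₁)) e
  ...   | ()

  extend-just′ : ∀ w₁ c {y} (e : lookup (extend w₁) c ≡ just y) →
    lookup w₁ (proj₁ (extend-just w₁ c e)) ≡ just y
  extend-just′ w₁ c e with extend-just w₁ c e
  ... | c' , refl = trans (sym (extend-inject₁ w₁ c')) e

  extend-isFilling : ∀ w₁ → IsFilling λ₀ (extend w₁) ⇔ IsFilling λ₁ w₁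
  extend-isFilling w₁ = mk⇔
    (λ (inBoard , rowsDistinct) →
       (λ c y e → inBoard (inject₁ c) y (trans (extend-inject₁ w₁ c) e)) ,
       (λ c d y e₁ e₂ → FP.inject₁-injective
          (rowsDistinct _ _ y (trans (extend-inject₁ w₁ c) e₁) (trans (extend-inject₁ w₁ d) e₂))))
    (λ (inBoard , rowsDistinct) →
       (λ c y e → subst (λ z → y < col z) (sym (proj₂ (extend-just w₁ c e)))
                    (inBoard _ y (extend-just′ w₁ c e))) ,
       (λ c d y e₁ e₂ → trans (proj₂ (extend-just w₁ c e₁))
          (trans (cong inject₁ (rowsDistinct _ _ y (extend-just′ w₁ c e₁) (extend-just′ w₁ d e₂)))
                 (sym (proj₂ (extend-just w₁ d e₂))))))

  extend-emptyCols : ∀ {C} → L ∈ C → ∀ w₁ →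
    EmptyCols λ₀ (extend w₁) C ⇔ EmptyCols λ₁ w₁ (restrict inject₁ C)
  extend-emptyCols {C} L∈C w₁ = mk⇔
    (λ empty c → ⇔.trans (∈-restrict inject₁ C c) (⇔.trans (empty (inject₁ c)) (old c)))
    columnsOfλ₀
    where
    old : ∀ c → (lookup (extend w₁) (inject₁ c) ≡ nothing) ⇔ (lookup w₁ c ≡ nothing)
    old c = mk⇔ (trans (sym (extend-inject₁ w₁ c))) (trans (extend-inject₁ w₁ c))
    columnsOfλ₀ : EmptyCols λ₁ w₁ (restrict inject₁ C) → EmptyCols λ₀ (extend w₁) C
    columnsOfλ₀ empty c with lastOrInject₁ c
    ... | inj₁ refl = mk⇔ (λ _ → extend-L w₁) (λ _ → L∈C)
    ... | inj₂ (c' , refl) = ⇔.trans (⇔.sym (∈-restrict inject₁ C c')) (⇔.trans (empty c') (⇔.sym (old c')))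

  extend-emptyRows : ∀ {R} w₁ → EmptyRows λ₀ (extend w₁) R ⇔ EmptyRows λ₁ w₁ R
  extend-emptyRows w₁ = mk⇔
    (λ empty ρ → ⇔.trans (empty ρ) (mk⇔ (λ u c e → u (inject₁ c) (trans (extend-inject₁ w₁ c) e))
                                         (λ u c e → u _ (extend-just′ w₁ c e))))
    (λ empty ρ → ⇔.trans (empty ρ) (mk⇔ (λ u c e → u _ (extend-just′ w₁ c e))
                                         (λ u c e → u (inject₁ c) (trans (extend-inject₁ w₁ c) e))))

  extend-contains⁺ : ∀ p w₁ → Contains λ₁ w₁ p → Contains λ₀ (extend w₁) p
  extend-contains⁺ p w₁ (i , v , mono , look , order , adjacent , inBoard) =
    (λ a → inject₁ (i a)) , v ,
    (λ a b a<b → subst₂ _<_ (sym (FP.toℕ-inject₁ (i a))) (sym (FP.toℕ-inject₁ (i b))) (mono a b a<b)) ,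
    (λ a → trans (extend-inject₁ w₁ (i a)) (look a)) , order ,
    (λ j j∈X → trans (FP.toℕ-inject₁ (i (Fin.suc j)))
                 (trans (adjacent j j∈X) (cong suc (sym (FP.toℕ-inject₁ (i (inject₁ j))))))) ,
    inBoard

  -- An occurrence in extend w₁ avoids the empty column L, so it lives in w₁.
  extend-contains⁻ : ∀ p w₁ → Contains λ₀ (extend w₁) p → Contains λ₁ w₁ p
  extend-contains⁻ p w₁ (i , v , mono , look , order , adjacent , inBoard) =
    i₁ , v , mono₁ , look₁ , order , adjacent₁ , inBoard₁
    where
    notL : ∀ a → suc n ≢ toℕ (i a)
    notL a n≡i with extend-just w₁ (i a) (look a)
    ... | c' , i≡c' = FP.fromℕ≢inject₁ (trans (FP.toℕ-injective (trans (FP.toℕ-fromℕ (suc n)) n≡i)) i≡c')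
    i₁ : Fin (len p) → Fin (suc n)
    i₁ a = lower₁ (i a) (notL a)
    inject₁-i₁ : ∀ a → inject₁ (i₁ a) ≡ i a
    inject₁-i₁ a = FP.inject₁-lower₁ (i a) (notL a)
    toℕ-i₁ : ∀ a → toℕ (i₁ a) ≡ toℕ (i a)
    toℕ-i₁ a = FP.toℕ-lower₁ (i a) (notL a)
    mono₁ : ∀ a b → a Fin.< b → i₁ a Fin.< i₁ b
    mono₁ a b a<b = subst₂ _<_ (sym (toℕ-i₁ a)) (sym (toℕ-i₁ b)) (mono a b a<b)
    look₁ : ∀ a → lookup w₁ (i₁ a) ≡ just (v a)
    look₁ a = trans (sym (extend-inject₁ w₁ (i₁ a))) (trans (cong (lookup (extend w₁)) (inject₁-i₁ a)) (look a))
    adjacent₁ : ∀ j → j ∈ X p → toℕ (i₁ (Fin.suc j)) ≡ suc (toℕ (i₁ (inject₁ j)))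
    adjacent₁ j j∈X = trans (toℕ-i₁ _) (trans (adjacent j j∈X) (cong suc (sym (toℕ-i₁ _))))
    inBoard₁ : maxF (m p) v < col (inject₁ (i₁ (fromℕ (m p))))
    inBoard₁ = subst (λ z → maxF (m p) v < col z) (sym (inject₁-i₁ _)) inBoard

  extend-InS : ∀ {C R} → L ∈ C → ∀ p w₁ →
    InS λ₀ C R p (extend w₁) ⇔ InS λ₁ (restrict inject₁ C) R p w₁
  extend-InS L∈C p w₁ =
    extend-isFilling w₁ ×-⇔ extend-emptyCols L∈C w₁ ×-⇔ extend-emptyRows w₁ ×-⇔
    ¬-cong-⇔ (mk⇔ (extend-contains⁻ p w₁) (extend-contains⁺ p w₁))

  sameSize-deleteLastColumn : ∀ {C R} (σ τ : Vincular) → L ∈ C →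
    SameSize (InS λ₁ (restrict inject₁ C) R σ) (InS λ₁ (restrict inject₁ C) R τ) →
    SameSize (InS λ₀ C R σ) (InS λ₀ C R τ)
  sameSize-deleteLastColumn {C} {R} σ τ L∈C =
    sameSize-transport Vec.init extend (columnIsEmpty σ) (columnIsEmpty τ) (VP.init-∷ʳ nothing)
      (extend-InS L∈C σ) (extend-InS L∈C τ)
    where
    columnIsEmpty : ∀ p w → InS λ₀ C R p w → w ≡ extend (Vec.init w)
    columnIsEmpty p w (_ , empty , _) = extend∘init w (to (empty L) L∈C)

blank-avoids : ∀ λ' (w : Word (width λ')) p → (∀ c → lookup w c ≡ nothing) → Avoids λ' w p
blank-avoids λ' w p blank (i , v , _ , look , _) with trans (sym (blank (i Fin.zero))) (look Fin.zero)
... | ()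

noRows-InS : ∀ λ' C (R : Subset (height λ')) → (∀ ρ → ρ ∉ R) →
  ∀ p w → InS λ' C R p w ⇔ InS λ' C ⊥ p w
noRows-InS λ' C R none p w = ⇔.refl ×-⇔ ⇔.refl ×-⇔ rows ×-⇔ ⇔.refl
  where
  rows : EmptyRows λ' w R ⇔ EmptyRows λ' w ⊥
  rows = mk⇔
    (λ empty ρ → mk⇔ (λ ρ∈⊥ → ⊥-elim (∉⊥ ρ∈⊥)) (λ u → ⊥-elim (none ρ (from (empty ρ) u))))
    (λ empty ρ → mk⇔ (λ ρ∈R → ⊥-elim (none ρ ρ∈R)) (λ u → ⊥-elim (∉⊥ (from (empty ρ) u))))

-- If the last column is not in C but all of its rows are in R, there is no
-- filling: the 1 of the last column would lie in a row required to be empty.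
noFillings : ∀ n col cp cd C (R : Subset (col Fin.zero)) → fromℕ n ∉ C →
  (∀ ρ → toℕ ρ < col (fromℕ n) → ρ ∈ R) → ∀ p w → ¬ InS (mkBoard n col cp cd) C R p w
noFillings n col cp cd C R L∉C forcedR p w ((inBoard , _) , emptyCols , emptyRows , _)
  with lookup w (fromℕ n) in e
... | nothing = L∉C (from (emptyCols (fromℕ n)) e)
... | just x = to (emptyRows ρ) (forcedR ρ (subst (_< col (fromℕ n)) (sym toℕ-ρ) x<col))
                 (fromℕ n) (trans e (cong just (sym toℕ-ρ)))
  where
  x<col : x < col (fromℕ n)
  x<col = inBoard (fromℕ n) x e
  x<H : x < col Fin.zero
  x<H = ℕP.<-≤-trans x<col (cd Fin.zero (fromℕ n) z≤n)
  ρ : Fin (col Fin.zero)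
  ρ = fromℕ< x<H
  toℕ-ρ : toℕ ρ ≡ x
  toℕ-ρ = FP.toℕ-fromℕ< x<H

oneColumn : ∀ col cp cd C (R : Subset (col Fin.zero)) → Fin.zero ∈ C → (∀ ρ → ρ ∈ R) →
  ∀ p → HasSize (InS (mkBoard 0 col cp cd) C R p) 1
oneColumn col cp cd C R z∈C allR p =
  hasSize-single _ blank
    (((λ { Fin.zero _ () }) , (λ { Fin.zero _ _ () })) ,
     (λ { Fin.zero → mk⇔ (λ _ → refl) (λ _ → z∈C) }) ,
     (λ ρ → mk⇔ (λ _ → λ { Fin.zero () }) (λ _ → allR ρ)) ,
     blank-avoids (mkBoard 0 col cp cd) blank p (λ { Fin.zero → refl }))
    (λ { (x ∷ []) (_ , emptyCols , _) → cong (_∷ []) (to (emptyCols Fin.zero) z∈C) })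
  where
  blank : Word 1
  blank = nothing ∷ []

module Induction (σ τ : Vincular)
  (hyp : ∀ (λ' : YoungBoard) (C : Subset (width λ')) → SameSize (InS λ' C ⊥ σ) (InS λ' C ⊥ τ)) where

  Goal : (λ' : YoungBoard) → Subset (width λ') → Subset (height λ') → Set
  Goal λ' C R = SameSize (InS λ' C R σ) (InS λ' C R τ)

  Below : ℕ → Set
  Below k = ∀ λ' → width λ' + height λ' ≤ k → ∀ C R → Goal λ' C R

  rowsFree : ∀ λ' C R → (∀ ρ → ρ ∉ R) → Goal λ' C R
  rowsFree λ' C R none =
    sameSize-transport (λ w → w) (λ w → w) (λ _ _ → refl) (λ _ _ → refl) (λ _ → refl)
      (noRows-InS λ' C R none σ) (noRows-InS λ' C R none τ) (hyp λ' C)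

  rowDeletable : ∀ {k} → Below k → ∀ n col cp cd → suc n + col Fin.zero ≤ suc k →
    ∀ C R (r : Fin (col Fin.zero)) → r ∈ R →
    ∀ ρ → toℕ ρ < col (fromℕ n) → ρ ∉ R → Goal (mkBoard n col cp cd) C R
  rowDeletable {k} IH n col cp cd size≤ C R r r∈R ρ ρ<col ρ∉R =
    sameSize-deleteRow σ τ r∈R (IH λ₁ smaller C (restrict rowOf R))
    where
    stillNonempty : ∀ c → 0 < cut (toℕ r) (col c)
    stillNonempty c = cut-pos (toℕ r) (toℕ ρ) (col c)
      (ℕP.<-≤-trans ρ<col (cd c (fromℕ n) (FP.≤fromℕ c)))
      (λ ρ≡r → ρ∉R (subst (_∈ R) (sym (FP.toℕ-injective ρ≡r)) r∈R))
    open DeleteRow n col cp cd r stillNonempty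
    smaller : suc n + cut (toℕ r) (col Fin.zero) ≤ k
    smaller = ℕP.≤-pred (ℕP.≤-trans (ℕP.+-monoʳ-< (suc n) (cut< (toℕ r) _ (FP.toℕ<n r))) size≤)

  lastColumnEmpty : ∀ {k} → Below k → ∀ n col cp cd → suc n + col Fin.zero ≤ suc k →
    ∀ C R → fromℕ n ∈ C → (∀ ρ → toℕ ρ < col (fromℕ n) → ρ ∈ R) → Goal (mkBoard n col cp cd) C R
  lastColumnEmpty IH zero col cp cd _ C R L∈C forcedR =
    1 , oneColumn col cp cd C R L∈C allR σ , oneColumn col cp cd C R L∈C allR τ
    where
    allR : ∀ ρ → ρ ∈ R
    allR ρ = forcedR ρ (FP.toℕ<n ρ)
  lastColumnEmpty IH (suc n) col cp cd size≤ C R L∈C _ =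
    sameSize-deleteLastColumn σ τ L∈C (IH λ₁ (ℕP.≤-pred size≤) (restrict inject₁ C) R)
    where open DeleteLastColumn n col cp cd

  below : ∀ k → Below k
  below k λ'@record { width = zero } _ C R = rowsFree λ' C R (λ ())
  below zero record { width = suc n } () C R
  below (suc k) record { width = suc n ; col = col ; col-pos = cp ; col-dec = cd } size≤ C R
    with nonempty? R
  ... | no noRow = rowsFree (mkBoard n col cp cd) C R (λ ρ ρ∈R → noRow (ρ , ρ∈R))
  ... | yes (r , r∈R) with FP.any? (λ ρ → (toℕ ρ <? col (fromℕ n)) ×-dec ¬? (ρ ∈? R))
  ...   | yes (ρ , ρ<col , ρ∉R) = rowDeletable (below k) n col cp cd size≤ C R r r∈R ρ ρ<col ρ∉R
  ...   | no noFreeRow with fromℕ n ∈? C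
  ...     | yes L∈C = lastColumnEmpty (below k) n col cp cd size≤ C R L∈C (forced R _ noFreeRow)
  ...     | no L∉C = 0 , hasSize-none _ (noFillings n col cp cd C R L∉C (forced R _ noFreeRow) σ)
                       , hasSize-none _ (noFillings n col cp cd C R L∉C (forced R _ noFreeRow) τ)

corollary1p5 : (σ τ : Vincular) →
    (∀ (λ' : YoungBoard) (C : Subset (width λ')) →
    SameSize (InS λ' C ⊥ σ) (InS λ' C ⊥ τ)) →
    FillingShapeWilfEquiv σ τ
corollary1p5 σ τ hyp λ' C R = Induction.below σ τ hyp _ λ' ℕP.≤-refl C R
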